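{- Let $\mathcal{W}=(\mathcal{L},f)$ be a weighted lattice. Suppose there exists $\theta\in\mathbb{R}_{>0}$ such that $\mathbb{P}(\mathcal{W}';\theta)\ge 0$ for every minor $\mathcal{W}'$ of $\mathcal{W}$. Let $U\in\mathcal{L}$ be such that $\mathbb{P}(\mathcal{W}|_U;\theta)>0$. Then there exist a complement $V$ of $U$ in $\mathcal{L}$ and an element $T\le V$ such that $\mathbb{P}(\mathcal{W}/T;\theta)>0$.
   Context: $\mathcal{L}$ is a finite modular complemented lattice with least element $\mathbf{0}$ and greatest element $\mathbf{1}$; a complement of $U$ is $V$ with $U\wedge V=\mathbf 0$ and $U\vee V=\mathbf 1$; $\mu$ is its Möbius function. A weighted lattice is $\mathcal{W}=(\mathcal{L},f)$ with $f:\mathcal{L}\to\mathbb{N}_0$, $f(\mathbf{0})=0$, $f$ monotone. For $X\le Y$, the minor $\mathcal{W}([X,Y])$ is the weighted lattice on $[X,Y]$ with weight $T\mapsto f(T)-f(X)$; $\mathcal{W}|_Y=\mathcal{W}([\mathbf{0},Y])$, $\mathcal{W}/X=\mathcal{W}([X,\mathbf{1}])$. Characteristic polynomial: $\mathbb{P}(\mathcal{W}([X,Y]);z)=\sum_{A\in[X,Y]}\mu(X,A)z^{f(Y)-f(A)}$. -}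

module Defs where

open import Data.Nat using (ℕ; zero; suc; _∸_)
import Data.Nat as ℕ
open import Data.Integer using (ℤ; +_; -[1+_])
open import Data.Fin using (Fin; _≟_)
open import Data.List using (List; foldr; filter; allFin)
open import Data.Product using (Σ; _×_; _,_)
open import Data.Sum using (_⊎_)
open import Relation.Nullary using (¬_; Dec; yes; no)
open import Relation.Unary using (Decidable)
open import Relation.Binary.PropositionalEquality using (_≡_)
open import Algebra.Structures using (IsCommutativeRing)

-- Ordered fields (ℝ is not available; the scalar θ lives in an arbitrary
-- ordered field, of which ℝ is an instance).  Equality is propositional.

record OrderedField : Set₁ where
  field
    Carrier : Set
    _+_ _*_ : Carrier → Carrier → Carrier
    -_      : Carrier → Carrier
    0# 1#   : Carrier
    isCommutativeRing : IsCommutativeRing _≡_ _+_ _*_ -_ 0# 1#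
    _⁻¹     : Carrier → Carrier
    ⁻¹-inverse : ∀ x → ¬ (x ≡ 0#) → x * (x ⁻¹) ≡ 1#
    0≢1     : ¬ (0# ≡ 1#)
    _<_     : Carrier → Carrier → Set
    <-irrefl : ∀ x → ¬ (x < x)
    <-trans  : ∀ {x y z} → x < y → y < z → x < z
    <-trichotomy : ∀ x y → x < y ⊎ (x ≡ y ⊎ y < x)
    +-mono-<  : ∀ {x y} z → x < y → (x + z) < (y + z)
    *-pos     : ∀ {x y} → 0# < x → 0# < y → 0# < (x * y)

  _≤_ : Carrier → Carrier → Set
  x ≤ y = x < y ⊎ x ≡ y

  _^_ : Carrier → ℕ → Carrier
  x ^ zero  = 1#
  x ^ suc k = x * (x ^ k)

  fromℕ : ℕ → Carrier
  fromℕ zero    = 0#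
  fromℕ (suc k) = 1# + fromℕ k

  fromℤ : ℤ → Carrier
  fromℤ (+ k)      = fromℕ k
  fromℤ -[1+ k ]   = - (fromℕ (suc k))

record FiniteModularComplementedLattice : Set₁ where
  field
    size  : ℕ
  Elem : Set
  Elem = Fin size
  field
    _≤_    : Elem → Elem → Set
    _≤?_   : ∀ x y → Dec (x ≤ y)
    ≤-refl    : ∀ x → x ≤ x
    ≤-antisym : ∀ {x y} → x ≤ y → y ≤ x → x ≡ y
    ≤-trans   : ∀ {x y z} → x ≤ y → y ≤ z → x ≤ z
    _∧_ _∨_ : Elem → Elem → Elem
    ∧-lb₁ : ∀ x y → (x ∧ y) ≤ x
    ∧-lb₂ : ∀ x y → (x ∧ y) ≤ y
    ∧-glb : ∀ {x y z} → z ≤ x → z ≤ y → z ≤ (x ∧ y)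
    ∨-ub₁ : ∀ x y → x ≤ (x ∨ y)
    ∨-ub₂ : ∀ x y → y ≤ (x ∨ y)
    ∨-lub : ∀ {x y z} → x ≤ z → y ≤ z → (x ∨ y) ≤ z
    𝟎 𝟏 : Elem
    𝟎-least    : ∀ x → 𝟎 ≤ x
    𝟏-greatest : ∀ x → x ≤ 𝟏
    modular : ∀ {x z} y → x ≤ z → (x ∨ (y ∧ z)) ≡ ((x ∨ y) ∧ z)

  IsComplement : Elem → Elem → Set
  IsComplement U V = (U ∧ V) ≡ 𝟎 × (U ∨ V) ≡ 𝟏

  field
    complemented : ∀ U → Σ Elem (IsComplement U)

  _<_ : Elem → Elem → Set
  x < y = x ≤ y × ¬ (x ≡ y)

  _<?_ : ∀ x y → Dec (x < y)
  x <? y with x ≤? y | x ≟ y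
  ... | yes p | no q  = yes (p , q)
  ... | yes _ | yes e = no λ { (_ , q) → q e }
  ... | no p  | _     = no λ { (r , _) → p r }

  elems : List Elem
  elems = allFin size

  sumℤ : {P : Elem → Set} → Decidable P → (Elem → ℤ) → ℤ
  sumℤ P? g = foldr (λ a s → g a Data.Integer.+ s) (+ 0) (filter P? elems)

  -- Möbius function by the standard recursion
  --   μ(X,X) = 1,  μ(X,Y) = - Σ_{X ≤ A < Y} μ(X,A) for X < Y,  0 otherwise,
  -- with a fuel parameter; fuel = size suffices since every strict chain
  -- has fewer than size steps.
  μ-fuel : ℕ → Elem → Elem → ℤ
  μ-fuel zero    X Y = + 0
  μ-fuel (suc k) X Y with X ≟ Y | X ≤? Y
  ... | yes _ | _     = + 1
  ... | no _  | no _  = + 0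
  ... | no _  | yes _ =
    Data.Integer.- sumℤ (λ A → (X ≤? A) Relation.Nullary.×-dec (A <? Y)) (μ-fuel k X)

  μ : Elem → Elem → ℤ
  μ = μ-fuel (suc size)

record WeightedLattice : Set₁ where
  field
    lattice : FiniteModularComplementedLattice
  open FiniteModularComplementedLattice lattice
  field
    f : Elem → ℕ
    f-𝟎 : f 𝟎 ≡ 0
    f-mono : ∀ {x y} → x ≤ y → f x ℕ.≤ f y

  -- Characteristic polynomial of the minor W([X,Y]) evaluated at z:
  --   Σ_{A ∈ [X,Y]} μ(X,A) z^{(f Y - f X) - (f A - f X)} = Σ μ(X,A) z^{f Y - f A}
  charPoly : (F : OrderedField) → Elem → Elem → OrderedField.Carrier F → OrderedField.Carrier F
  charPoly F X Y z =
    foldr (λ A s → (fromℤ (μ X A) * (z ^ (f Y ∸ f A))) + s) 0#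
          (filter (λ A → (X ≤? A) Relation.Nullary.×-dec (A ≤? Y)) elems)
    where open OrderedField F

{-# OPTIONS --safe #-}
-- Expanding [T ∧ U = 𝟎] = Σ_{A ≤ T ∧ U} μ(𝟎, A) and using Möbius inversion on both sides,
-- Σ_{A ≤ Y} μ(X, A) = δ(X, Y) = Σ_{X ≤ T} μ(T, Y), one obtains
--   Σ_{T ∧ U = 𝟎} P(W/T; z) = z^(f(𝟏) - f(U)) · P(W|_U; z).
-- At z = θ > 0 the right-hand side is positive, hence so is some summand: P(W/T; θ) > 0 for a T
-- with T ∧ U = 𝟎, and by modularity such a T lies below a complement of U.
module Submission where

open import Defs
open import Algebra.Bundles using (CommutativeRing)
open import Data.Bool using (if_then_else_)
open import Data.Empty using (⊥-elim)
open import Data.Fin using (Fin; zero; suc; _≟_)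
open import Data.Fin.Subset using (Subset; inside; outside; _∈_; _⊂_; ∣_∣)
open import Data.Fin.Subset.Properties using (p⊂q⇒∣p∣<∣q∣; ∣p∣≤n)
open import Data.Integer as ℤ using (ℤ)
import Data.Integer.Properties as ℤ
open import Data.List using (List; []; _∷_; foldr; filter; tabulate)
open import Data.Nat as ℕ using (ℕ; zero; suc; _∸_)
import Data.Nat.Properties as ℕ
open import Data.Product using (Σ; _×_; _,_; proj₁; proj₂)
open import Data.Sum using (_⊎_; inj₁; inj₂)
import Data.Vec as Vec
open import Data.Vec.Functional using (Vector)
open import Data.Vec.Properties using (lookup∘tabulate; []=⇒lookup; lookup⇒[]=)
open import Function using (_∘_; id)
open import Relation.Nullary using (¬_; Dec; yes; no; does; _×-dec_)
open import Relation.Unary using (Decidable)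
open import Relation.Binary.PropositionalEquality
  using (_≡_; refl; sym; trans; cong; cong₂; subst; subst₂; module ≡-Reasoning)

module OrderedFieldProperties (F : OrderedField) where
  open OrderedField F public
    using (Carrier; isCommutativeRing; _^_; fromℕ; fromℤ; <-irrefl; <-trans; <-trichotomy; +-mono-<; *-pos; 0≢1)
    renaming (_<_ to infix 4 _<_; _≤_ to infix 4 _≤_)

  commutativeRing : CommutativeRing _ _
  commutativeRing = record { isCommutativeRing = isCommutativeRing }

  open CommutativeRing commutativeRing public
    using (_+_; _*_; -_; 0#; 1#; +-assoc; +-comm; +-identityˡ; +-identityʳ; -‿inverseʳ;
           *-assoc; *-comm; *-identityˡ; zeroˡ; zeroʳ; distribʳ; -‿inverseˡ; +-congˡ; +-congʳ; *-congˡ; *-congʳ;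
           ring; semiring;
           +-commutativeSemigroup; *-commutativeSemigroup; *-commutativeMonoid)
  open import Algebra.Properties.Ring ring public
    using (+-cancelʳ; -‿involutive; -0#≈0#; -‿distribˡ-*; -‿+-comm)
  open import Algebra.Properties.Semiring.Sum semiring public
    using (sum; sum-cong-≗; sum-replicate-zero; ∑-distrib-+; ∑-comm; *-distribˡ-sum; *-distribʳ-sum)
  open import Algebra.Properties.CommutativeSemigroup +-commutativeSemigroup public
    using () renaming (interchange to +-interchange)
  open import Algebra.Properties.CommutativeSemigroup *-commutativeSemigroup public
    using () renaming (x∙yz≈y∙xz to *-lcomm)
  open ≡-Reasoning

  0<1 : 0# < 1#
  0<1 with <-trichotomy 0# 1#
  ... | inj₁ 0<1 = 0<1
  ... | inj₂ (inj₁ 0≡1) = ⊥-elim (0≢1 0≡1)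
  ... | inj₂ (inj₂ 1<0) = ⊥-elim (<-irrefl 1# (<-trans 1<0 0<[-1]*[-1]))
    where
      0<-1 : 0# < - 1#
      0<-1 = subst₂ _<_ (-‿inverseʳ 1#) (+-identityˡ (- 1#)) (+-mono-< (- 1#) 1<0)
      [-1]*[-1]≡1 : - 1# * - 1# ≡ 1#
      [-1]*[-1]≡1 = begin
        - 1# * - 1#    ≡⟨ -‿distribˡ-* 1# (- 1#) ⟨
        - (1# * - 1#)  ≡⟨ cong -_ (*-identityˡ (- 1#)) ⟩
        - - 1#         ≡⟨ -‿involutive 1# ⟩
        1#             ∎
      0<[-1]*[-1] : 0# < 1#
      0<[-1]*[-1] = subst (0# <_) [-1]*[-1]≡1 (*-pos 0<-1 0<-1)

  ^-pos : ∀ {x} k → 0# < x → 0# < x ^ k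
  ^-pos zero    _   = 0<1
  ^-pos (suc k) 0<x = *-pos 0<x (^-pos k 0<x)

  ^-+ : ∀ x m n → x ^ m * x ^ n ≡ x ^ (m ℕ.+ n)
  ^-+ x zero    n = *-identityˡ (x ^ n)
  ^-+ x (suc m) n = trans (*-assoc x (x ^ m) (x ^ n)) (cong (x *_) (^-+ x m n))

  <-≤-trans : ∀ {x y z} → x < y → y ≤ z → x < z
  <-≤-trans x<y (inj₁ y<z)  = <-trans x<y y<z
  <-≤-trans x<y (inj₂ refl) = x<y

  pos⊎nonpos : ∀ x → 0# < x ⊎ x ≤ 0#
  pos⊎nonpos x with <-trichotomy 0# x
  ... | inj₁ 0<x        = inj₁ 0<x
  ... | inj₂ (inj₁ 0≡x) = inj₂ (inj₂ (sym 0≡x))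
  ... | inj₂ (inj₂ x<0) = inj₂ (inj₁ x<0)

  +-nonpos : ∀ {x y} → x ≤ 0# → y ≤ 0# → x + y ≤ 0#
  +-nonpos {y = y} (inj₂ refl) y≤0 = subst (_≤ 0#) (sym (+-identityˡ y)) y≤0
  +-nonpos {x} {y} (inj₁ x<0)  y≤0 =
    inj₁ (<-≤-trans (subst (x + y <_) (+-identityˡ y) (+-mono-< y x<0)) y≤0)

  fromℕ-+ : ∀ m n → fromℕ (m ℕ.+ n) ≡ fromℕ m + fromℕ n
  fromℕ-+ zero    n = sym (+-identityˡ (fromℕ n))
  fromℕ-+ (suc m) n = trans (cong (1# +_) (fromℕ-+ m n)) (sym (+-assoc 1# (fromℕ m) (fromℕ n)))

  fromℤ-⊖ : ∀ m n → fromℤ (m ℤ.⊖ n) ≡ fromℕ m + - fromℕ n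
  fromℤ-⊖ m zero = begin
    fromℤ (m ℤ.⊖ 0)    ≡⟨ cong fromℤ (ℤ.⊖-≥ {m} ℕ.z≤n) ⟩
    fromℕ m           ≡⟨ +-identityʳ (fromℕ m) ⟨
    fromℕ m + 0#      ≡⟨ cong (fromℕ m +_) -0#≈0# ⟨
    fromℕ m + - 0#    ∎
  fromℤ-⊖ zero (suc n) = begin
    fromℤ (0 ℤ.⊖ suc n)        ≡⟨ cong fromℤ (ℤ.⊖-< {0} {suc n} ℕ.z<s) ⟩
    - fromℕ (suc n)            ≡⟨ +-identityˡ _ ⟨
    0# + - fromℕ (suc n)       ∎
  fromℤ-⊖ (suc m) (suc n) = begin
    fromℤ (suc m ℤ.⊖ suc n)               ≡⟨ cong fromℤ (ℤ.[1+m]⊖[1+n]≡m⊖n m n) ⟩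
    fromℤ (m ℤ.⊖ n)                       ≡⟨ fromℤ-⊖ m n ⟩
    fromℕ m + - fromℕ n                   ≡⟨ +-identityˡ _ ⟨
    0# + (fromℕ m + - fromℕ n)            ≡⟨ cong (_+ (fromℕ m + - fromℕ n)) (-‿inverseʳ 1#) ⟨
    (1# + - 1#) + (fromℕ m + - fromℕ n)   ≡⟨ +-interchange 1# (- 1#) (fromℕ m) (- fromℕ n) ⟩
    (1# + fromℕ m) + (- 1# + - fromℕ n)   ≡⟨ cong ((1# + fromℕ m) +_) (-‿+-comm 1# (fromℕ n)) ⟩
    (1# + fromℕ m) + - (1# + fromℕ n)     ∎

  fromℤ-+ : ∀ i j → fromℤ (i ℤ.+ j) ≡ fromℤ i + fromℤ j
  fromℤ-+ ℤ.-[1+ m ] ℤ.-[1+ n ] = begin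
    - fromℕ (suc (suc (m ℕ.+ n)))        ≡⟨ cong (-_ ∘ fromℕ ∘ suc) (ℕ.+-suc m n) ⟨
    - fromℕ (suc m ℕ.+ suc n)            ≡⟨ cong -_ (fromℕ-+ (suc m) (suc n)) ⟩
    - (fromℕ (suc m) + fromℕ (suc n))    ≡⟨ -‿+-comm _ _ ⟨
    - fromℕ (suc m) + - fromℕ (suc n)    ∎
  fromℤ-+ ℤ.-[1+ m ] (ℤ.+ n)    = trans (fromℤ-⊖ n (suc m)) (+-comm _ _)
  fromℤ-+ (ℤ.+ m)    ℤ.-[1+ n ] = fromℤ-⊖ m (suc n)
  fromℤ-+ (ℤ.+ m)    (ℤ.+ n)    = fromℕ-+ m n

  fromℤ-neg : ∀ i → fromℤ (ℤ.- i) ≡ - fromℤ i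
  fromℤ-neg ℤ.-[1+ n ]    = sym (-‿involutive _)
  fromℤ-neg (ℤ.+ zero)    = sym -0#≈0#
  fromℤ-neg (ℤ.+ suc n)   = refl

  fromℤ-foldr : ∀ {A : Set} (g : A → ℤ) (xs : List A) →
    fromℤ (foldr (λ a s → g a ℤ.+ s) (ℤ.+ 0) xs) ≡ foldr (λ a s → fromℤ (g a) + s) 0# xs
  fromℤ-foldr g []       = refl
  fromℤ-foldr g (x ∷ xs) = trans (fromℤ-+ (g x) _) (cong (fromℤ (g x) +_) (fromℤ-foldr g xs))

  [_] : ∀ {P : Set} → Dec P → Carrier
  [ d ] = if does d then 1# else 0#

  [yes] : ∀ {P : Set} (d : Dec P) → P → [ d ] ≡ 1#
  [yes] (yes _) _ = refl
  [yes] (no ¬p) p = ⊥-elim (¬p p)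

  [no] : ∀ {P : Set} (d : Dec P) → ¬ P → [ d ] ≡ 0#
  [no] (yes p) ¬p = ⊥-elim (¬p p)
  [no] (no _)  _  = refl

  [⇔] : ∀ {P Q : Set} → (P → Q) → (Q → P) → (a : Dec P) (b : Dec Q) → [ a ] ≡ [ b ]
  [⇔] P→Q Q→P (yes p) b = sym ([yes] b (P→Q p))
  [⇔] P→Q Q→P (no ¬p) b = sym ([no] b (¬p ∘ Q→P))

  [×] : ∀ {P Q : Set} (a : Dec P) (b : Dec Q) → [ a ×-dec b ] ≡ [ a ] * [ b ]
  [×] (yes _) (yes _) = sym (*-identityˡ 1#)
  [×] (yes _) (no _)  = sym (zeroʳ 1#)
  [×] (no _)  b       = sym (zeroˡ [ b ])

  [*]-absorb : ∀ {P : Set} (d : Dec P) {x} → (¬ P → x ≡ 0#) → [ d ] * x ≡ x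
  [*]-absorb (yes _) _    = *-identityˡ _
  [*]-absorb (no ¬p) x≡0 = trans (zeroˡ _) (sym (x≡0 ¬p))

  [*]-cong : ∀ {P : Set} (d : Dec P) {x y} → (P → x ≡ y) → [ d ] * x ≡ [ d ] * y
  [*]-cong (yes p) x≡y = cong (1# *_) (x≡y p)
  [*]-cong (no _)  _   = trans (zeroˡ _) (sym (zeroˡ _))

  [*]-vanish : ∀ {P : Set} (d : Dec P) {x} → (P → x ≡ 0#) → [ d ] * x ≡ 0#
  [*]-vanish (yes p) x≡0 = trans (*-identityˡ _) (x≡0 p)
  [*]-vanish (no _)  _   = zeroˡ _

  [*]-pos : ∀ {P : Set} (d : Dec P) {x} → 0# < [ d ] * x → P × 0# < x
  [*]-pos (yes p) 0<x = p , subst (0# <_) (*-identityˡ _) 0<x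
  [*]-pos (no _)  0<0 = ⊥-elim (<-irrefl 0# (subst (0# <_) (zeroˡ _) 0<0))

  foldr-filter : ∀ {A : Set} {P : A → Set} (P? : Decidable P) (g : A → Carrier) {n} (t : Fin n → A) →
    foldr (λ a s → g a + s) 0# (filter P? (tabulate t)) ≡ sum λ i → [ P? (t i) ] * g (t i)
  foldr-filter P? g {zero}  t = refl
  foldr-filter P? g {suc n} t with P? (t zero)
  ... | yes _ = cong₂ _+_ (sym (*-identityˡ _)) (foldr-filter P? g (t ∘ suc))
  ... | no _  = trans (foldr-filter P? g (t ∘ suc)) (sym (trans (+-congʳ (zeroˡ (g (t zero)))) (+-identityˡ _)))

  sum-zero : ∀ {n} {h : Vector Carrier n} → (∀ i → h i ≡ 0#) → sum h ≡ 0#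
  sum-zero {n} h≡0 = trans (sum-cong-≗ h≡0) (sum-replicate-zero n)

  sum-δ : ∀ {n} (j : Fin n) (h : Vector Carrier n) → sum (λ i → [ i ≟ j ] * h i) ≡ h j
  sum-δ zero    h = trans (cong₂ _+_ (*-identityˡ (h zero)) (sum-zero λ i → zeroˡ (h (suc i)))) (+-identityʳ _)
  sum-δ (suc j) h = trans (cong₂ _+_ (zeroˡ (h zero)) (sum-δ j (h ∘ suc))) (+-identityˡ _)

  sum-pos : ∀ {n} (h : Vector Carrier n) → 0# < sum h → Σ (Fin n) λ i → 0# < h i
  sum-pos {zero}  h 0<0 = ⊥-elim (<-irrefl 0# 0<0)
  sum-pos {suc n} h 0<∑ with pos⊎nonpos (h zero) | pos⊎nonpos (sum (h ∘ suc))
  ... | inj₁ 0<h₀ | _        = zero , 0<h₀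
  ... | inj₂ _    | inj₁ 0<∑ = let i , 0<hᵢ = sum-pos (h ∘ suc) 0<∑ in suc i , 0<hᵢ
  ... | inj₂ h₀≤0 | inj₂ ∑≤0 = ⊥-elim (<-irrefl 0# (<-≤-trans 0<∑ (+-nonpos h₀≤0 ∑≤0)))

module LatticeProperties (L : FiniteModularComplementedLattice) where
  open FiniteModularComplementedLattice L public
    renaming ( _≤_ to infix 4 _≤_; _<_ to infix 4 _<_; _≤?_ to infix 4 _≤?_; _<?_ to infix 4 _<?_
             ; _∧_ to infixr 7 _∧_; _∨_ to infixr 6 _∨_)

  -- V = T ∨ W for a complement W of U ∨ T: modularity gives V ∧ (U ∨ T) = T, so U ∧ V ≤ T ∧ U = 𝟎.
  extend-to-complement : ∀ U T → T ∧ U ≡ 𝟎 → Σ Elem λ V → IsComplement U V × T ≤ V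
  extend-to-complement U T T∧U≡𝟎 with complemented (U ∨ T)
  ... | W , [U∨T]∧W≡𝟎 , [U∨T]∨W≡𝟏 = V , (U∧V≡𝟎 , U∨V≡𝟏) , ∨-ub₁ T W
    where
      V : Elem
      V = T ∨ W
      U∨V≡𝟏 : U ∨ V ≡ 𝟏
      U∨V≡𝟏 = ≤-antisym (𝟏-greatest _) (subst (_≤ U ∨ V) [U∨T]∨W≡𝟏
        (∨-lub (∨-lub (∨-ub₁ U V) (≤-trans (∨-ub₁ T W) (∨-ub₂ U V)))
               (≤-trans (∨-ub₂ T W) (∨-ub₂ U V))))
      W∧[U∨T]≤𝟎 : W ∧ (U ∨ T) ≤ 𝟎
      W∧[U∨T]≤𝟎 = subst (W ∧ (U ∨ T) ≤_) [U∨T]∧W≡𝟎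
        (∧-glb (∧-lb₂ W (U ∨ T)) (∧-lb₁ W (U ∨ T)))
      V∧[U∨T]≤T : V ∧ (U ∨ T) ≤ T
      V∧[U∨T]≤T = subst (_≤ T) (modular W (∨-ub₂ U T))
        (∨-lub (≤-refl T) (≤-trans W∧[U∨T]≤𝟎 (𝟎-least T)))
      U∧V≤T∧U : U ∧ V ≤ T ∧ U
      U∧V≤T∧U = ∧-glb (≤-trans (∧-glb (∧-lb₂ U V) (≤-trans (∧-lb₁ U V) (∨-ub₁ U T))) V∧[U∨T]≤T)
                      (∧-lb₁ U V)
      U∧V≡𝟎 : U ∧ V ≡ 𝟎
      U∧V≡𝟎 = ≤-antisym (subst (U ∧ V ≤_) T∧U≡𝟎 U∧V≤T∧U) (𝟎-least _)

  <-≤-trans : ∀ {x y z} → x < y → y ≤ z → x < z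
  <-≤-trans (x≤y , x≢y) y≤z = ≤-trans x≤y y≤z , λ { refl → x≢y (≤-antisym x≤y y≤z) }

  strictlyBelow : Elem → Subset size
  strictlyBelow Y = Vec.tabulate λ B → if does (B <? Y) then inside else outside

  ∈-strictlyBelow⇒< : ∀ {B Y} → B ∈ strictlyBelow Y → B < Y
  ∈-strictlyBelow⇒< {B} {Y} B∈ with B <? Y | trans (sym (lookup∘tabulate _ B)) ([]=⇒lookup B∈)
  ... | yes B<Y | _ = B<Y
  ... | no _    | ()

  <⇒∈-strictlyBelow : ∀ {B Y} → B < Y → B ∈ strictlyBelow Y
  <⇒∈-strictlyBelow {B} {Y} B<Y = lookup⇒[]= B _ (trans (lookup∘tabulate _ B) inside-if-<)
    where
      inside-if-< : (if does (B <? Y) then inside else outside) ≡ inside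
      inside-if-< with B <? Y
      ... | yes _   = refl
      ... | no B≮Y  = ⊥-elim (B≮Y B<Y)

  strictlyBelow-⊂ : ∀ {A Y} → A < Y → strictlyBelow A ⊂ strictlyBelow Y
  strictlyBelow-⊂ {A} A<Y =
      (λ B∈ → <⇒∈-strictlyBelow (<-≤-trans (∈-strictlyBelow⇒< B∈) (proj₁ A<Y)))
    , A , <⇒∈-strictlyBelow A<Y , λ A∈ → proj₂ (∈-strictlyBelow⇒< A∈) refl

  -- Bounds the recursion depth of μ-fuel at Y.
  height : Elem → ℕ
  height Y = ∣ strictlyBelow Y ∣

  height-< : ∀ {A Y} → A < Y → height A ℕ.< height Y
  height-< = p⊂q⇒∣p∣<∣q∣ ∘ strictlyBelow-⊂

  height≤size : ∀ Y → height Y ℕ.≤ size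
  height≤size Y = ∣p∣≤n (strictlyBelow Y)

  sumℤ-cong : ∀ {P : Elem → Set} (P? : Decidable P) {g g′ : Elem → ℤ} →
    (∀ A → P A → g A ≡ g′ A) → sumℤ P? g ≡ sumℤ P? g′
  sumℤ-cong P? {g} {g′} g≡g′ = go elems
    where
      go : ∀ xs → foldr (λ a s → g a ℤ.+ s) (ℤ.+ 0) (filter P? xs)
                ≡ foldr (λ a s → g′ a ℤ.+ s) (ℤ.+ 0) (filter P? xs)
      go []       = refl
      go (x ∷ xs) with P? x
      ... | yes p = cong₂ ℤ._+_ (g≡g′ x p) (go xs)
      ... | no _  = go xs

  μ-fuel-≰ : ∀ k {X Y} → ¬ X ≤ Y → μ-fuel k X Y ≡ ℤ.+ 0
  μ-fuel-≰ zero    X≰Y = refl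
  μ-fuel-≰ (suc k) {X} {Y} X≰Y with X ≟ Y | X ≤? Y
  ... | yes refl | _      = ⊥-elim (X≰Y (≤-refl X))
  ... | no _     | yes X≤Y = ⊥-elim (X≰Y X≤Y)
  ... | no _     | no _    = refl

  μ-fuel-refl : ∀ k X → μ-fuel (suc k) X X ≡ ℤ.+ 1
  μ-fuel-refl k X with X ≟ X
  ... | yes _   = refl
  ... | no X≢X  = ⊥-elim (X≢X refl)

  μ-fuel-unfold : ∀ k {X Y} → X < Y →
    μ-fuel (suc k) X Y ≡ ℤ.- sumℤ (λ A → (X ≤? A) ×-dec (A <? Y)) (μ-fuel k X)
  μ-fuel-unfold k {X} {Y} (X≤Y , X≢Y) with X ≟ Y | X ≤? Y
  ... | yes X≡Y | _       = ⊥-elim (X≢Y X≡Y)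
  ... | no _    | no X≰Y  = ⊥-elim (X≰Y X≤Y)
  ... | no _    | yes _   = refl

  μ-fuel-stable : ∀ k k′ X Y → height Y ℕ.< k → height Y ℕ.< k′ → μ-fuel k X Y ≡ μ-fuel k′ X Y
  μ-fuel-stable (suc k) (suc k′) X Y (ℕ.s≤s hY≤k) (ℕ.s≤s hY≤k′) with X ≟ Y | X ≤? Y
  ... | yes _ | _     = refl
  ... | no _  | no _  = refl
  ... | no _  | yes _ = cong ℤ.-_ (sumℤ-cong _ λ A (_ , A<Y) →
          μ-fuel-stable k k′ X A (ℕ.<-≤-trans (height-< A<Y) hY≤k) (ℕ.<-≤-trans (height-< A<Y) hY≤k′))

  μ-unfold : ∀ {X Y} → X < Y → μ X Y ≡ ℤ.- sumℤ (λ A → (X ≤? A) ×-dec (A <? Y)) (μ X)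
  μ-unfold {X} {Y} X<Y = trans (μ-fuel-unfold size X<Y) (cong ℤ.-_ (sumℤ-cong _ λ A (_ , A<Y) →
    μ-fuel-stable size (suc size) X A (below-size A<Y) (ℕ.m≤n⇒m≤1+n (below-size A<Y))))
    where
      below-size : ∀ {A} → A < Y → height A ℕ.< size
      below-size A<Y = ℕ.<-≤-trans (height-< A<Y) (height≤size Y)

module Möbius (F : OrderedField) (L : FiniteModularComplementedLattice) where
  open OrderedFieldProperties F hiding (_<_; _≤_)
  open LatticeProperties L
  open import Algebra.Solver.CommutativeMonoid *-commutativeMonoid using (solve; _⊕_; _⊜_)
  open ≡-Reasoning

  μᶠ : Elem → Elem → Carrier
  μᶠ X Y = fromℤ (μ X Y)

  sumℤ≡sum : ∀ {P : Elem → Set} (P? : Decidable P) (g : Elem → ℤ) →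
    fromℤ (sumℤ P? g) ≡ sum λ A → [ P? A ] * fromℤ (g A)
  sumℤ≡sum P? g = trans (fromℤ-foldr g (filter P? elems)) (foldr-filter P? (fromℤ ∘ g) id)

  μᶠ-≰ : ∀ {X Y} → ¬ X ≤ Y → μᶠ X Y ≡ 0#
  μᶠ-≰ X≰Y = cong fromℤ (μ-fuel-≰ (suc size) X≰Y)

  μᶠ-refl : ∀ X → μᶠ X X ≡ 1#
  μᶠ-refl X = trans (cong fromℤ (μ-fuel-refl size X)) (+-identityʳ 1#)

  μᶠ-unfold : ∀ {X Y} → X < Y → μᶠ X Y ≡ - sum λ A → [ A <? Y ] * μᶠ X A
  μᶠ-unfold {X} {Y} X<Y = begin
    μᶠ X Y                                  ≡⟨ cong fromℤ (μ-unfold X<Y) ⟩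
    fromℤ (ℤ.- sumℤ between? (μ X))         ≡⟨ fromℤ-neg (sumℤ between? (μ X)) ⟩
    - fromℤ (sumℤ between? (μ X))           ≡⟨ cong -_ (sumℤ≡sum between? (μ X)) ⟩
    - sum (λ A → [ between? A ] * μᶠ X A)   ≡⟨ cong -_ (sum-cong-≗ drop-≤) ⟩
    - sum (λ A → [ A <? Y ] * μᶠ X A)       ∎
    where
      between? : Decidable λ A → X ≤ A × A < Y
      between? A = (X ≤? A) ×-dec (A <? Y)
      drop-≤ : ∀ A → [ between? A ] * μᶠ X A ≡ [ A <? Y ] * μᶠ X A
      drop-≤ A = begin
        [ between? A ] * μᶠ X A                 ≡⟨ cong (_* μᶠ X A) ([×] (X ≤? A) (A <? Y)) ⟩
        [ X ≤? A ] * [ A <? Y ] * μᶠ X A        ≡⟨ cong (_* μᶠ X A) (*-comm _ _) ⟩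
        [ A <? Y ] * [ X ≤? A ] * μᶠ X A        ≡⟨ *-assoc _ _ _ ⟩
        [ A <? Y ] * ([ X ≤? A ] * μᶠ X A)      ≡⟨ cong ([ A <? Y ] *_) ([*]-absorb (X ≤? A) μᶠ-≰) ⟩
        [ A <? Y ] * μᶠ X A                     ∎

  [≤]≡[≟]+[<] : ∀ A Y → [ A ≤? Y ] ≡ [ A ≟ Y ] + [ A <? Y ]
  [≤]≡[≟]+[<] A Y with A ≟ Y | A <? Y
  ... | yes refl | yes (_ , A≢A)  = ⊥-elim (A≢A refl)
  ... | yes refl | no _           = trans ([yes] (A ≤? A) (≤-refl A)) (sym (+-identityʳ 1#))
  ... | no _     | yes (A≤Y , _)  = trans ([yes] (A ≤? Y) A≤Y) (sym (+-identityˡ 1#))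
  ... | no A≢Y   | no A≮Y         = trans ([no] (A ≤? Y) λ A≤Y → A≮Y (A≤Y , A≢Y)) (sym (+-identityˡ 0#))

  sum-≤-split : ∀ Y (h : Elem → Carrier) →
    sum (λ A → [ A ≤? Y ] * h A) ≡ h Y + sum λ A → [ A <? Y ] * h A
  sum-≤-split Y h = begin
    sum (λ A → [ A ≤? Y ] * h A)
      ≡⟨ sum-cong-≗ (λ A → cong (_* h A) ([≤]≡[≟]+[<] A Y)) ⟩
    sum (λ A → ([ A ≟ Y ] + [ A <? Y ]) * h A)
      ≡⟨ sum-cong-≗ (λ A → distribʳ (h A) [ A ≟ Y ] [ A <? Y ]) ⟩
    sum (λ A → [ A ≟ Y ] * h A + [ A <? Y ] * h A)
      ≡⟨ ∑-distrib-+ (λ A → [ A ≟ Y ] * h A) (λ A → [ A <? Y ] * h A) ⟩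
    sum (λ A → [ A ≟ Y ] * h A) + sum (λ A → [ A <? Y ] * h A)
      ≡⟨ +-congʳ (sum-δ Y h) ⟩
    h Y + sum (λ A → [ A <? Y ] * h A) ∎

  μ⋆ζ≡δ : ∀ X Y → sum (λ A → [ A ≤? Y ] * μᶠ X A) ≡ [ X ≟ Y ]
  μ⋆ζ≡δ X Y with X ≟ Y | X ≤? Y
  ... | yes refl | _ = begin
    sum (λ A → [ A ≤? X ] * μᶠ X A)          ≡⟨ sum-≤-split X (μᶠ X) ⟩
    μᶠ X X + sum (λ A → [ A <? X ] * μᶠ X A)
      ≡⟨ cong₂ _+_ (μᶠ-refl X) (sum-zero λ A → [*]-vanish (A <? X) (μᶠ-≰ ∘ <⇒≱)) ⟩
    1# + 0#                                  ≡⟨ +-identityʳ 1# ⟩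
    1#                                       ∎
    where
      <⇒≱ : ∀ {A} → A < X → ¬ X ≤ A
      <⇒≱ (A≤X , A≢X) X≤A = A≢X (≤-antisym A≤X X≤A)
  ... | no X≢Y | yes X≤Y = begin
    sum (λ A → [ A ≤? Y ] * μᶠ X A)          ≡⟨ sum-≤-split Y (μᶠ X) ⟩
    μᶠ X Y + sum (λ A → [ A <? Y ] * μᶠ X A) ≡⟨ +-congʳ (μᶠ-unfold (X≤Y , X≢Y)) ⟩
    - sum (λ A → [ A <? Y ] * μᶠ X A) + sum (λ A → [ A <? Y ] * μᶠ X A) ≡⟨ -‿inverseˡ _ ⟩
    0#                                       ∎
  ... | no _ | no X≰Y =
    sum-zero λ A → [*]-vanish (A ≤? Y) λ A≤Y → μᶠ-≰ {X} {A} λ X≤A → X≰Y (≤-trans X≤A A≤Y)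

  [≟]-sym : ∀ (X Y : Elem) → [ X ≟ Y ] ≡ [ Y ≟ X ]
  [≟]-sym X Y = [⇔] sym sym (X ≟ Y) (Y ≟ X)

  [≤∧] : ∀ A T U → [ A ≤? T ∧ U ] ≡ [ A ≤? T ] * [ A ≤? U ]
  [≤∧] A T U = trans ([⇔] ≤∧⇒ (λ (A≤T , A≤U) → ∧-glb A≤T A≤U) (A ≤? T ∧ U) ((A ≤? T) ×-dec (A ≤? U)))
                     ([×] (A ≤? T) (A ≤? U))
    where
      ≤∧⇒ : A ≤ T ∧ U → A ≤ T × A ≤ U
      ≤∧⇒ A≤T∧U = ≤-trans A≤T∧U (∧-lb₁ T U) , ≤-trans A≤T∧U (∧-lb₂ T U)

  ζ⋆μ : Elem → Elem → Carrier
  ζ⋆μ X Y = sum λ T → [ X ≤? T ] * μᶠ T Y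

  ζ⋆μ⋆ζ≡ζ : ∀ X Y → sum (λ A → [ A ≤? Y ] * ζ⋆μ X A) ≡ [ X ≤? Y ]
  ζ⋆μ⋆ζ≡ζ X Y = begin
    sum (λ A → [ A ≤? Y ] * sum (λ T → [ X ≤? T ] * μᶠ T A))
      ≡⟨ sum-cong-≗ (λ A → *-distribˡ-sum [ A ≤? Y ] (λ T → [ X ≤? T ] * μᶠ T A)) ⟩
    sum (λ A → sum (λ T → [ A ≤? Y ] * ([ X ≤? T ] * μᶠ T A)))
      ≡⟨ ∑-comm (λ A T → [ A ≤? Y ] * ([ X ≤? T ] * μᶠ T A)) ⟩
    sum (λ T → sum (λ A → [ A ≤? Y ] * ([ X ≤? T ] * μᶠ T A)))
      ≡⟨ sum-cong-≗ (λ T → sum-cong-≗ (λ A → *-lcomm [ A ≤? Y ] [ X ≤? T ] (μᶠ T A))) ⟩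
    sum (λ T → sum (λ A → [ X ≤? T ] * ([ A ≤? Y ] * μᶠ T A)))
      ≡⟨ sum-cong-≗ (λ T → *-distribˡ-sum [ X ≤? T ] (λ A → [ A ≤? Y ] * μᶠ T A)) ⟨
    sum (λ T → [ X ≤? T ] * sum (λ A → [ A ≤? Y ] * μᶠ T A))
      ≡⟨ sum-cong-≗ (λ T → trans (*-congˡ (μ⋆ζ≡δ T Y)) (*-comm [ X ≤? T ] [ T ≟ Y ])) ⟩
    sum (λ T → [ T ≟ Y ] * [ X ≤? T ])
      ≡⟨ sum-δ Y (λ T → [ X ≤? T ]) ⟩
    [ X ≤? Y ] ∎

  -- μ ⋆ ζ = δ gives ζ ⋆ μ ⋆ ζ = ζ, which determines ζ ⋆ μ = δ by induction on the height of Y.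
  ζ⋆μ≡δ : ∀ X Y → ζ⋆μ X Y ≡ [ X ≟ Y ]
  ζ⋆μ≡δ X Y = by-height (suc (height Y)) Y ℕ.≤-refl
    where
      by-height : ∀ k Y → height Y ℕ.< k → ζ⋆μ X Y ≡ [ X ≟ Y ]
      by-height (suc k) Y (ℕ.s≤s hY≤k) = +-cancelʳ [ X <? Y ] (ζ⋆μ X Y) [ X ≟ Y ] (begin
        ζ⋆μ X Y + [ X <? Y ]                           ≡⟨ +-congˡ strictly-below ⟨
        ζ⋆μ X Y + sum (λ A → [ A <? Y ] * ζ⋆μ X A)     ≡⟨ sum-≤-split Y (ζ⋆μ X) ⟨
        sum (λ A → [ A ≤? Y ] * ζ⋆μ X A)               ≡⟨ ζ⋆μ⋆ζ≡ζ X Y ⟩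
        [ X ≤? Y ]                                     ≡⟨ [≤]≡[≟]+[<] X Y ⟩
        [ X ≟ Y ] + [ X <? Y ]                         ∎)
        where
          strictly-below : sum (λ A → [ A <? Y ] * ζ⋆μ X A) ≡ [ X <? Y ]
          strictly-below = begin
            sum (λ A → [ A <? Y ] * ζ⋆μ X A)
              ≡⟨ sum-cong-≗ (λ A → [*]-cong (A <? Y) λ A<Y →
                   by-height k A (ℕ.<-≤-trans (height-< A<Y) hY≤k)) ⟩
            sum (λ A → [ A <? Y ] * [ X ≟ A ])
              ≡⟨ sum-cong-≗ (λ A → trans (*-comm _ _) (*-congʳ ([≟]-sym X A))) ⟩
            sum (λ A → [ A ≟ X ] * [ A <? Y ])
              ≡⟨ sum-δ X (λ A → [ A <? Y ]) ⟩
            [ X <? Y ] ∎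

  sum-over-disjoint : ∀ U (g : Elem → Carrier) →
    sum (λ T → [ T ∧ U ≟ 𝟎 ] * sum (λ B → μᶠ T B * g B)) ≡ sum λ A → [ A ≤? U ] * μᶠ 𝟎 A * g A
  sum-over-disjoint U g = begin
    sum (λ T → [ T ∧ U ≟ 𝟎 ] * sum (λ B → μᶠ T B * g B))
      ≡⟨ sum-cong-≗ (λ T → *-congʳ (trans ([≟]-sym (T ∧ U) 𝟎) (sym (μ⋆ζ≡δ 𝟎 (T ∧ U))))) ⟩
    sum (λ T → sum (λ A → [ A ≤? T ∧ U ] * μᶠ 𝟎 A) * sum (λ B → μᶠ T B * g B))
      ≡⟨ sum-cong-≗ (λ T →
           trans (*-distribʳ-sum (sum λ B → μᶠ T B * g B) (λ A → [ A ≤? T ∧ U ] * μᶠ 𝟎 A))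
                 (sum-cong-≗ λ A → *-distribˡ-sum ([ A ≤? T ∧ U ] * μᶠ 𝟎 A) (λ B → μᶠ T B * g B))) ⟩
    sum (λ T → sum (λ A → sum (λ B → [ A ≤? T ∧ U ] * μᶠ 𝟎 A * (μᶠ T B * g B))))
      ≡⟨ sum-cong-≗ (λ T → sum-cong-≗ λ A → sum-cong-≗ λ B →
           trans (*-congʳ (*-congʳ ([≤∧] A T U))) (regroup [ A ≤? T ] [ A ≤? U ] (μᶠ 𝟎 A) (μᶠ T B) (g B))) ⟩
    sum (λ T → sum (λ A → sum (λ B → c A * (g B * ([ A ≤? T ] * μᶠ T B)))))
      ≡⟨ ∑-comm (λ T A → sum λ B → c A * (g B * ([ A ≤? T ] * μᶠ T B))) ⟩
    sum (λ A → sum (λ T → sum (λ B → c A * (g B * ([ A ≤? T ] * μᶠ T B)))))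
      ≡⟨ sum-cong-≗ (λ A → ∑-comm (λ T B → c A * (g B * ([ A ≤? T ] * μᶠ T B)))) ⟩
    sum (λ A → sum (λ B → sum (λ T → c A * (g B * ([ A ≤? T ] * μᶠ T B)))))
      ≡⟨ sum-cong-≗ (λ A → sum-cong-≗ λ B →
           trans (cong (c A *_) (*-distribˡ-sum (g B) (λ T → [ A ≤? T ] * μᶠ T B)))
                 (*-distribˡ-sum (c A) (λ T → g B * ([ A ≤? T ] * μᶠ T B)))) ⟨
    sum (λ A → sum (λ B → c A * (g B * ζ⋆μ A B)))
      ≡⟨ sum-cong-≗ (λ A → sum-cong-≗ λ B →
           trans (*-congˡ (*-congˡ (trans (ζ⋆μ≡δ A B) ([≟]-sym A B)))) (bring-forward (c A) (g B) [ B ≟ A ])) ⟩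
    sum (λ A → sum (λ B → [ B ≟ A ] * (c A * g B)))
      ≡⟨ sum-cong-≗ (λ A → sum-δ A (λ B → c A * g B)) ⟩
    sum (λ A → c A * g A) ∎
    where
      c : Elem → Carrier
      c A = [ A ≤? U ] * μᶠ 𝟎 A
      regroup : ∀ t u m μ g → t * u * m * (μ * g) ≡ u * m * (g * (t * μ))
      regroup = solve 5 (λ t u m μ g → ((t ⊕ u) ⊕ m) ⊕ (μ ⊕ g) ⊜ (u ⊕ m) ⊕ (g ⊕ (t ⊕ μ))) refl
      bring-forward : ∀ c g δ → c * (g * δ) ≡ δ * (c * g)
      bring-forward = solve 3 (λ c g δ → c ⊕ (g ⊕ δ) ⊜ δ ⊕ (c ⊕ g)) refl

∸-+-∸ : ∀ {a b c} → c ℕ.≤ b → b ℕ.≤ a → (a ∸ b) ℕ.+ (b ∸ c) ≡ a ∸ c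
∸-+-∸ {a} {b} {c} c≤b b≤a = trans (sym (ℕ.+-∸-assoc (a ∸ b) c≤b)) (cong (_∸ c) (ℕ.m∸n+n≡m b≤a))

module CharacteristicPolynomial (F : OrderedField) (W : WeightedLattice) where
  open OrderedFieldProperties F
  open WeightedLattice W using (lattice; f; f-mono; charPoly)
  open LatticeProperties lattice using (Elem; 𝟎; 𝟏; 𝟎-least; 𝟏-greatest; _≤?_; _∧_)
  open Möbius F lattice using (μᶠ; μᶠ-≰; sum-over-disjoint)
  open ≡-Reasoning

  charPoly≡sum : ∀ X Y z → charPoly F X Y z ≡ sum λ A → [ X ≤? A ×-dec A ≤? Y ] * (μᶠ X A * z ^ (f Y ∸ f A))
  charPoly≡sum X Y z = foldr-filter _ (λ A → μᶠ X A * z ^ (f Y ∸ f A)) id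

  charPoly-contraction : ∀ T z → charPoly F T 𝟏 z ≡ sum λ B → μᶠ T B * z ^ (f 𝟏 ∸ f B)
  charPoly-contraction T z = trans (charPoly≡sum T 𝟏 z) (sum-cong-≗ λ B →
    [*]-absorb (T ≤? B ×-dec B ≤? 𝟏) λ T≰B≤𝟏 →
      trans (*-congʳ (μᶠ-≰ λ T≤B → T≰B≤𝟏 (T≤B , 𝟏-greatest B))) (zeroˡ (z ^ (f 𝟏 ∸ f B))))

  charPoly-restriction : ∀ U z →
    z ^ (f 𝟏 ∸ f U) * charPoly F 𝟎 U z ≡ sum λ A → [ A ≤? U ] * μᶠ 𝟎 A * z ^ (f 𝟏 ∸ f A)
  charPoly-restriction U z = begin
    z ^ k * charPoly F 𝟎 U z
      ≡⟨ *-congˡ (charPoly≡sum 𝟎 U z) ⟩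
    z ^ k * sum (λ A → [ 𝟎 ≤? A ×-dec A ≤? U ] * (μᶠ 𝟎 A * z ^ (f U ∸ f A)))
      ≡⟨ *-distribˡ-sum (z ^ k) (λ A → [ 𝟎 ≤? A ×-dec A ≤? U ] * (μᶠ 𝟎 A * z ^ (f U ∸ f A))) ⟩
    sum (λ A → z ^ k * ([ 𝟎 ≤? A ×-dec A ≤? U ] * (μᶠ 𝟎 A * z ^ (f U ∸ f A))))
      ≡⟨ sum-cong-≗ shift ⟩
    sum (λ A → [ A ≤? U ] * μᶠ 𝟎 A * z ^ (f 𝟏 ∸ f A)) ∎
    where
      k : ℕ
      k = f 𝟏 ∸ f U
      shift : ∀ A → z ^ k * ([ 𝟎 ≤? A ×-dec A ≤? U ] * (μᶠ 𝟎 A * z ^ (f U ∸ f A)))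
                  ≡ [ A ≤? U ] * μᶠ 𝟎 A * z ^ (f 𝟏 ∸ f A)
      shift A with A ≤? U
      ... | no A≰U = begin
        z ^ k * ([ 𝟎 ≤? A ×-dec no A≰U ] * (μᶠ 𝟎 A * z ^ (f U ∸ f A)))
          ≡⟨ *-congˡ ([*]-vanish (𝟎 ≤? A ×-dec no A≰U) λ (_ , A≤U) → ⊥-elim (A≰U A≤U)) ⟩
        z ^ k * 0#                                 ≡⟨ zeroʳ (z ^ k) ⟩
        0#                                         ≡⟨ zeroˡ (z ^ (f 𝟏 ∸ f A)) ⟨
        0# * z ^ (f 𝟏 ∸ f A)                       ≡⟨ *-congʳ (zeroˡ (μᶠ 𝟎 A)) ⟨
        0# * μᶠ 𝟎 A * z ^ (f 𝟏 ∸ f A)              ∎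
      ... | yes A≤U = begin
        z ^ k * ([ 𝟎 ≤? A ×-dec yes A≤U ] * (μᶠ 𝟎 A * z ^ (f U ∸ f A)))
          ≡⟨ *-congˡ ([*]-absorb (𝟎 ≤? A ×-dec yes A≤U) λ 𝟎≰A → ⊥-elim (𝟎≰A (𝟎-least A , A≤U))) ⟩
        z ^ k * (μᶠ 𝟎 A * z ^ (f U ∸ f A))
          ≡⟨ *-lcomm (z ^ k) (μᶠ 𝟎 A) _ ⟩
        μᶠ 𝟎 A * (z ^ k * z ^ (f U ∸ f A))
          ≡⟨ *-congˡ (^-+ z k (f U ∸ f A)) ⟩
        μᶠ 𝟎 A * z ^ (k ℕ.+ (f U ∸ f A))
          ≡⟨ cong (λ n → μᶠ 𝟎 A * z ^ n) (∸-+-∸ (f-mono A≤U) (f-mono (𝟏-greatest U))) ⟩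
        μᶠ 𝟎 A * z ^ (f 𝟏 ∸ f A)
          ≡⟨ *-congʳ (*-identityˡ (μᶠ 𝟎 A)) ⟨
        1# * μᶠ 𝟎 A * z ^ (f 𝟏 ∸ f A) ∎

  sum-disjoint-contractions : ∀ U z →
    sum (λ T → [ T ∧ U ≟ 𝟎 ] * charPoly F T 𝟏 z) ≡ z ^ (f 𝟏 ∸ f U) * charPoly F 𝟎 U z
  sum-disjoint-contractions U z = begin
    sum (λ T → [ T ∧ U ≟ 𝟎 ] * charPoly F T 𝟏 z)
      ≡⟨ sum-cong-≗ (λ T → *-congˡ (charPoly-contraction T z)) ⟩
    sum (λ T → [ T ∧ U ≟ 𝟎 ] * sum (λ B → μᶠ T B * z ^ (f 𝟏 ∸ f B)))
      ≡⟨ sum-over-disjoint U (λ B → z ^ (f 𝟏 ∸ f B)) ⟩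
    sum (λ A → [ A ≤? U ] * μᶠ 𝟎 A * z ^ (f 𝟏 ∸ f A))
      ≡⟨ charPoly-restriction U z ⟨
    z ^ (f 𝟏 ∸ f U) * charPoly F 𝟎 U z ∎

  disjoint-positive-contraction : ∀ θ → 0# < θ → ∀ U → 0# < charPoly F 𝟎 U θ →
    Σ Elem λ T → T ∧ U ≡ 𝟎 × 0# < charPoly F T 𝟏 θ
  disjoint-positive-contraction θ 0<θ U 0<χ[U] =
    let T , 0<[T∧U≟𝟎]*χ[T] = sum-pos _ 0<sum in T , [*]-pos (T ∧ U ≟ 𝟎) 0<[T∧U≟𝟎]*χ[T]
    where
      0<sum : 0# < sum λ T → [ T ∧ U ≟ 𝟎 ] * charPoly F T 𝟏 θ
      0<sum = subst (0# <_) (sym (sum-disjoint-contractions U θ)) (*-pos (^-pos (f 𝟏 ∸ f U) 0<θ) 0<χ[U])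

open OrderedField using (Carrier) renaming (0# to 0F ; _<_ to lt ; _≤_ to le)
open WeightedLattice using (lattice ; charPoly)
open FiniteModularComplementedLattice using (Elem ; _≤_ ; 𝟎 ; 𝟏 ; IsComplement)

corollary3p10 : (F : OrderedField) (W : WeightedLattice)
    → (θ : Carrier F) → lt F (0F F) θ
    → (∀ (X Y : Elem (lattice W)) → _≤_ (lattice W) X Y → le F (0F F) (charPoly W F X Y θ))
    → (U : Elem (lattice W)) → lt F (0F F) (charPoly W F (𝟎 (lattice W)) U θ)
    → Σ (Elem (lattice W)) (λ V → IsComplement (lattice W) U V
        × Σ (Elem (lattice W)) (λ T → _≤_ (lattice W) T V × lt F (0F F) (charPoly W F T (𝟏 (lattice W)) θ)))
corollary3p10 F W θ 0<θ _ U 0<χ[U]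
  with CharacteristicPolynomial.disjoint-positive-contraction F W θ 0<θ U 0<χ[U]
... | T , T∧U≡𝟎 , 0<χ[T] with LatticeProperties.extend-to-complement (lattice W) U T T∧U≡𝟎
... | V , U-V-complement , T≤V = V , U-V-complement , T , T≤V , 0<χ[T]
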